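{- Let $d\ge3$, $h\ge1$ and let $\ell$ be a leaf of $\mathcal{T}(d,h)$. Then the exponent of the sandpile group $G(d,h)$ equals the order of $\bar{\mathbf{x}}_\ell$.
   Context: Let $\mathcal{T}(d,h)$ be the ball of radius $h$ about a root vertex $0$ in the infinite $d$-regular tree (root has $d$ children, vertices at depth $1,\dots,h-1$ have $d-1$ children, depth-$h$ vertices are leaves). Let $V$ be its vertex set, $p(i)$ the parent of $i\neq 0$, $C_i$ the children of $i$, $\{\mathbf{x}_i\}$ the standard basis of $\mathbb{Z}^V$, and $\delta_i = d\mathbf{x}_i - \mathbf{x}_{p(i)} - \sum_{j\in C_i}\mathbf{x}_j$ (omit $\mathbf{x}_{p(i)}$ for $i=0$; empty sum for leaves). The sandpile group is $G(d,h)=\mathbb{Z}^V/\sum_{i\in V}\mathbb{Z}\delta_i$, $\bar{\mathbf{v}}$ denotes the image of $\mathbf{v}\in\mathbb{Z}^V$, and the exponent is the lcm of the orders of all elements. -}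

module Defs where

open import Data.Nat as ℕ using (ℕ; zero; suc; _≤_; _<_; _<?_; s≤s; z≤n)
open import Data.Nat.Properties using (≤-trans; n≤1+n)
open import Data.Nat.Divisibility using (_∣_)
open import Data.Integer as ℤ using (ℤ; +_; _-_; _*_)
open import Data.Fin using (Fin; toℕ; zero; suc)
open import Data.Bool using (Bool; true; false; _∧_; if_then_else_)
open import Data.Unit using (⊤; tt)
open import Data.Product using (Σ; ∃; _×_; _,_)
open import Relation.Nullary using (yes; no)
open import Relation.Binary.PropositionalEquality using (_≡_)

-- Number of children of a vertex at depth k in T(d,h) (if k < h):
-- the root has d children, every other internal vertex has d - 1.
branch : ℕ → ℕ → ℕ
branch d zero    = d
branch d (suc _) = d ℕ.∸ 1

-- A vertex at depth k is encoded by the path of child indices from the root.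
Path : ℕ → ℕ → Set
Path d zero    = ⊤
Path d (suc k) = Path d k × Fin (branch d k)

record Vertex (d h : ℕ) : Set where
  constructor vtx
  field
    depth  : ℕ
    .bound : depth ≤ h
    path   : Path d depth
open Vertex public

eqPath : (d : ℕ) → {k k' : ℕ} → Path d k → Path d k' → Bool
eqPath d {zero}  {zero}   _       _         = true
eqPath d {suc k} {suc k'} (p , j) (p' , j') = eqPath d p p' ∧ (toℕ j ℕ.≡ᵇ toℕ j')
eqPath d {zero}  {suc _}  _       _         = false
eqPath d {suc _} {zero}   _       _         = false

ZV : ℕ → ℕ → Set
ZV d h = Vertex d h → ℤ

basis : {d h : ℕ} → Vertex d h → ZV d h
basis {d} ℓ j = if eqPath d (path ℓ) (path j) then + 1 else + 0

sumFin : (n : ℕ) → (Fin n → ℤ) → ℤ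
sumFin zero    f = + 0
sumFin (suc n) f = f zero ℤ.+ sumFin n (λ i → f (suc i))

-- The linear combination Σ_i c_i δ_i, evaluated at coordinate j:
-- (Σ_i c_i δ_i)_j = d c_j - c_{p(j)} - Σ_{k ∈ C_j} c_k
-- (parent term omitted for the root, child sum empty for leaves).
parentTerm : {d h : ℕ} → ZV d h → Vertex d h → ℤ
parentTerm c (vtx zero    b p)       = + 0
parentTerm c (vtx (suc k) b (p , _)) = c (vtx k (≤-trans (n≤1+n k) b) p)

childTerm : {d h : ℕ} → ZV d h → Vertex d h → ℤ
childTerm {d} {h} c (vtx k b p) with k <? h
... | yes k<h = sumFin (branch d k) (λ i → c (vtx (suc k) k<h (p , i)))
... | no  _   = + 0

combo : {d h : ℕ} → ZV d h → ZV d h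
combo {d} c j = (+ d * c j - parentTerm c j) - childTerm c j

-- v lies in the subgroup Σ_i ℤ δ_i (i.e. v̄ = 0 in G(d,h)).
InL : {d h : ℕ} → ZV d h → Set
InL {d} {h} v = ∃ λ (c : ZV d h) → ∀ j → v j ≡ combo c j

Annihilates : {d h : ℕ} → ℕ → ZV d h → Set
Annihilates n v = InL (λ j → + n * v j)

IsOrder : {d h : ℕ} → ZV d h → ℕ → Set
IsOrder v n = (0 < n) × Annihilates n v × (∀ m → 0 < m → Annihilates m v → n ≤ m)

IsExponent : (d h : ℕ) → ℕ → Set
IsExponent d h n =
  (∀ (v : ZV d h) m → IsOrder v m → m ∣ n) ×
  (∀ k → (∀ (v : ZV d h) m → IsOrder v m → m ∣ k) → n ∣ k)

-- Let δ : ℤ^V → ℤ^V be the map c ↦ Σ_i c_i δ_i, so that G(d,h) = ℤ^V / im δ, and put q = d − 1.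
-- δ is injective: if δu = 0 then Ψ(y)·|u(v)| ≤ Ψ(y+1)·|u(p(v))| for every vertex v of depth y+1
-- (by induction from the leaves), where Ψ(y) = 1 + q + ⋯ + q^(h−y); at the root this contradicts
-- Ψ(0) > Ψ(1) unless u = 0.  For a leaf ℓ, the vector G(v) = Γ(k)·Ψ(y), with y the depth of v and
-- k the depth at which v leaves the path from the root to ℓ, satisfies δG = D·x_ℓ for explicit
-- positive integers Γ(k), D.  By injectivity, m·x̄_ℓ = 0 iff D divides every m·G(v), so the order
-- of x̄_ℓ is D / gcd(D, G(v) : v ∈ V), independently of ℓ.  Finally
-- x_{p(c)} ≡ d·x_c − Σ_{c' ∈ C_c} x_{c'} modulo im δ, so by induction from the leaves this number
-- annihilates every x̄_j: it is the exponent.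

module Submission where

open import Defs
import Algebra.Properties.CommutativeSemigroup as CommutativeSemigroupProperties
open import Data.Bool using (Bool; true; false; _∧_; if_then_else_)
open import Data.Bool.Properties using (∧-conicalˡ; ∧-conicalʳ; T-≡)
open import Data.Empty using (⊥-elim)
open import Data.Fin using (Fin; zero; suc; toℕ)
open import Data.Fin.Properties using (toℕ-injective)
open import Data.Integer as Int using (ℤ; +_; -_; ∣_∣)
import Data.Integer.Properties as ℤᵖ
import Data.Integer.Tactic.RingSolver as ℤ-Solver
open import Data.Nat as Nat using (ℕ; zero; suc; _≤_; _<_; _<?_; _≡ᵇ_; z≤n; s≤s; z<s; NonZero)
open import Data.Nat.DivMod using (_%_; _/_; m≡m%n+[m/n]*n; m%n<n)
open import Data.Nat.Divisibility
  using (_∣_; divides; quotient; ∣-refl; ∣-trans; n∣m*n; *-cancelʳ-∣; ∣⇒≤; m%n≡0⇒n∣m)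
open import Data.Nat.GCD using (gcd; gcd[m,n]∣m; gcd[m,n]∣n; gcd-greatest; c*gcd[m,n]≡gcd[cm,cn]; gcd[m,n]≢0)
import Data.Nat.Properties as ℕᵖ
import Data.Nat.Tactic.RingSolver as ℕ-Solver
open import Data.Product using (Σ; ∃; _×_; _,_; proj₁; proj₂)
open import Data.Sum using (_⊎_; inj₁; inj₂)
open import Data.Unit using (tt)
open import Function using (_∘_; Equivalence)
open import Relation.Binary.PropositionalEquality
open import Relation.Nullary using (¬_; yes; no; contradiction)
open import Relation.Nullary.Decidable using (recompute)

module ℤ+ = CommutativeSemigroupProperties ℤᵖ.+-commutativeSemigroup
module ℕ+ = CommutativeSemigroupProperties ℕᵖ.+-commutativeSemigroup
module ℕ* = CommutativeSemigroupProperties ℕᵖ.*-commutativeSemigroup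

module _ where
  open Int using (_+_; _*_)

  indicator : Bool → ℤ
  indicator b = if b then + 1 else + 0

  sumFin-cong : ∀ n {f g : Fin n → ℤ} → (∀ i → f i ≡ g i) → sumFin n f ≡ sumFin n g
  sumFin-cong zero    f≗g = refl
  sumFin-cong (suc n) f≗g = cong₂ _+_ (f≗g zero) (sumFin-cong n (f≗g ∘ suc))

  sumFin-zero : ∀ n {f : Fin n → ℤ} → (∀ i → f i ≡ + 0) → sumFin n f ≡ + 0
  sumFin-zero zero    f≗0 = refl
  sumFin-zero (suc n) f≗0 = cong₂ _+_ (f≗0 zero) (sumFin-zero n (f≗0 ∘ suc))

  sumFin-+ : ∀ n (f g : Fin n → ℤ) → sumFin n (λ i → f i + g i) ≡ sumFin n f + sumFin n g
  sumFin-+ zero    f g = refl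
  sumFin-+ (suc n) f g = begin
    (f zero + g zero) + sumFin n (λ i → f (suc i) + g (suc i))
      ≡⟨ cong (_+_ (f zero + g zero)) (sumFin-+ n (f ∘ suc) (g ∘ suc)) ⟩
    (f zero + g zero) + (sumFin n (f ∘ suc) + sumFin n (g ∘ suc))
      ≡⟨ ℤ+.interchange (f zero) (g zero) _ _ ⟩
    (f zero + sumFin n (f ∘ suc)) + (g zero + sumFin n (g ∘ suc)) ∎
    where open ≡-Reasoning

  sumFin-*ˡ : ∀ n a (f : Fin n → ℤ) → sumFin n (λ i → a * f i) ≡ a * sumFin n f
  sumFin-*ˡ zero    a f = sym (ℤᵖ.*-zeroʳ a)
  sumFin-*ˡ (suc n) a f = trans (cong (_+_ (a * f zero)) (sumFin-*ˡ n a (f ∘ suc)))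
                                (sym (ℤᵖ.*-distribˡ-+ a (f zero) _))

  sumFin-const : ∀ n a → sumFin n (λ _ → + a) ≡ + (n Nat.* a)
  sumFin-const zero    a = refl
  sumFin-const (suc n) a = trans (cong (_+_ (+ a)) (sumFin-const n a)) (sym (ℤᵖ.pos-+ a (n Nat.* a)))

  sumFin-split : ∀ n (i₀ : Fin (suc n)) (H : Bool → ℕ) →
    sumFin (suc n) (λ i → + H (toℕ i ≡ᵇ toℕ i₀)) ≡ + (H true Nat.+ n Nat.* H false)
  sumFin-split n zero H =
    trans (cong (_+_ (+ H true)) (sumFin-const n (H false))) (sym (ℤᵖ.pos-+ (H true) _))
  sumFin-split (suc n) (suc i₀) H = begin
    + H false + sumFin (suc n) (λ i → + H (toℕ i ≡ᵇ toℕ i₀))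
      ≡⟨ cong (_+_ (+ H false)) (sumFin-split n i₀ H) ⟩
    + H false + + (H true Nat.+ n Nat.* H false)
      ≡⟨ sym (ℤᵖ.pos-+ (H false) _) ⟩
    + (H false Nat.+ (H true Nat.+ n Nat.* H false))
      ≡⟨ cong +_ (ℕ+.x∙yz≈y∙xz (H false) (H true) _) ⟩
    + (H true Nat.+ (H false Nat.+ n Nat.* H false)) ∎
    where open ≡-Reasoning

  sumFin-select : ∀ n (c : Bool) (i₀ : Fin n) (f : Fin n → ℤ) →
    sumFin n (λ i → f i * indicator (c ∧ (toℕ i ≡ᵇ toℕ i₀))) ≡ f i₀ * indicator c
  sumFin-select n false i₀ f = trans (sumFin-zero n (ℤᵖ.*-zeroʳ ∘ f)) (sym (ℤᵖ.*-zeroʳ (f i₀)))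
  sumFin-select (suc n) true zero f =
    trans (cong (_+_ (f zero * + 1)) (sumFin-zero n (ℤᵖ.*-zeroʳ ∘ f ∘ suc))) (ℤᵖ.+-identityʳ _)
  sumFin-select (suc n) true (suc i₀) f =
    trans (cong₂ _+_ (ℤᵖ.*-zeroʳ (f zero)) (sumFin-select n true i₀ (f ∘ suc))) (ℤᵖ.+-identityˡ _)

  sumFin-indicator : ∀ n (c : Bool) (i₀ : Fin n) →
    sumFin n (λ i → indicator (c ∧ (toℕ i ≡ᵇ toℕ i₀))) ≡ indicator c
  sumFin-indicator n c i₀ =
    trans (sumFin-cong n (λ i → sym (ℤᵖ.*-identityˡ _)))
          (trans (sumFin-select n c i₀ (λ _ → + 1)) (ℤᵖ.*-identityˡ (indicator c)))

K*∣sumFin∣≤n*B : ∀ n K B (f : Fin n → ℤ) → (∀ i → K Nat.* ∣ f i ∣ ≤ B) →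
  K Nat.* ∣ sumFin n f ∣ ≤ n Nat.* B
K*∣sumFin∣≤n*B zero    K B f bound = ℕᵖ.≤-reflexive (ℕᵖ.*-zeroʳ K)
K*∣sumFin∣≤n*B (suc n) K B f bound = begin
  K * ∣ f zero Int.+ sumFin n (f ∘ suc) ∣
    ≤⟨ ℕᵖ.*-monoʳ-≤ K (ℤᵖ.∣i+j∣≤∣i∣+∣j∣ (f zero) _) ⟩
  K * (∣ f zero ∣ + ∣ sumFin n (f ∘ suc) ∣)
    ≡⟨ ℕᵖ.*-distribˡ-+ K ∣ f zero ∣ _ ⟩
  K * ∣ f zero ∣ + K * ∣ sumFin n (f ∘ suc) ∣
    ≤⟨ ℕᵖ.+-mono-≤ (bound zero) (K*∣sumFin∣≤n*B n K B (f ∘ suc) (bound ∘ suc)) ⟩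
  B + n * B ∎
  where
  open Nat using (_+_; _*_)
  open ℕᵖ.≤-Reasoning

≡ᵇ-sym : ∀ m n → (m ≡ᵇ n) ≡ (n ≡ᵇ m)
≡ᵇ-sym zero    zero    = refl
≡ᵇ-sym zero    (suc n) = refl
≡ᵇ-sym (suc m) zero    = refl
≡ᵇ-sym (suc m) (suc n) = ≡ᵇ-sym m n

module _ {d : ℕ} where
  eqPath-refl : ∀ {k} (p : Path d k) → eqPath d p p ≡ true
  eqPath-refl {zero}  _       = refl
  eqPath-refl {suc k} (p , i) rewrite eqPath-refl p =
    Equivalence.to T-≡ (ℕᵖ.≡⇒≡ᵇ (toℕ i) (toℕ i) refl)

  eqPath-sound : ∀ {k k'} (p : Path d k) (p' : Path d k') → eqPath d p p' ≡ true →
    Σ (k ≡ k') λ k≡k' → subst (Path d) k≡k' p ≡ p'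
  eqPath-sound {zero}  {zero}   _       _         _  = refl , refl
  eqPath-sound {suc k} {suc k'} (p , i) (p' , i') eq
    with eqPath-sound p p' (∧-conicalˡ _ _ eq)
  ... | refl , refl =
    refl , cong (p ,_) (toℕ-injective (ℕᵖ.≡ᵇ⇒≡ _ _ (Equivalence.from T-≡ (∧-conicalʳ _ _ eq))))

  eqPath-depth : ∀ {k k'} (p : Path d k) (p' : Path d k') → k ≢ k' → eqPath d p p' ≡ false
  eqPath-depth p p' k≢k' with eqPath d p p' in eq
  ... | true  = ⊥-elim (k≢k' (proj₁ (eqPath-sound p p' eq)))
  ... | false = refl

  eqPath-sym : ∀ {k k'} (p : Path d k) (p' : Path d k') → eqPath d p p' ≡ eqPath d p' p
  eqPath-sym {zero}  {zero}   _       _         = refl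
  eqPath-sym {zero}  {suc _}  _       _         = refl
  eqPath-sym {suc _} {zero}   _       _         = refl
  eqPath-sym {suc _} {suc _}  (p , i) (p' , i') = cong₂ _∧_ (eqPath-sym p p') (≡ᵇ-sym (toℕ i) (toℕ i'))

  sumFin-child-indicator : ∀ {k k′} (p : Path d k) (p′ : Path d k′) (i₀ : Fin (branch d k′)) →
    sumFin (branch d k) (λ i → indicator (eqPath d (p , i) (p′ , i₀))) ≡ indicator (eqPath d p p′)
  sumFin-child-indicator {k} p p′ i₀ = by-eqPath (eqPath d p p′) refl
    where
    by-eqPath : ∀ b → eqPath d p p′ ≡ b →
      sumFin (branch d k) (λ i → indicator (eqPath d p p′ ∧ (toℕ i ≡ᵇ toℕ i₀))) ≡ indicator (eqPath d p p′)
    by-eqPath false p≢p′ = trans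
      (sumFin-zero (branch d k) (λ i → cong (λ b → indicator (b ∧ (toℕ i ≡ᵇ toℕ i₀))) p≢p′))
      (sym (cong indicator p≢p′))
    by-eqPath true p≡p′ with eqPath-sound p p′ p≡p′
    ... | refl , refl = sumFin-indicator (branch d k) (eqPath d p p) i₀

Ray : ℕ → Set
Ray d = (k : ℕ) → Fin (branch d k)

prefix : ∀ {d} → Ray d → (x : ℕ) → Path d x
prefix ray zero    = tt
prefix ray (suc x) = prefix ray x , ray x

firstChild : ∀ {e} k → Fin (branch (suc (suc (suc e))) k)
firstChild zero    = zero
firstChild (suc _) = zero

rayThrough : ∀ {d x} → Path d x → Ray d → Ray d
rayThrough {x = zero}  _       ray k = ray k
rayThrough {x = suc x} (p , i) ray k with k ℕᵖ.≟ x
... | yes refl = i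
... | no  _    = rayThrough p ray k

prefix-cong : ∀ {d} {ray ray′ : Ray d} x → (∀ {k} → k < x → ray k ≡ ray′ k) → prefix ray x ≡ prefix ray′ x
prefix-cong zero    _     = refl
prefix-cong (suc x) agree = cong₂ _,_ (prefix-cong x (agree ∘ ℕᵖ.m<n⇒m<1+n)) (agree (ℕᵖ.n<1+n x))

prefix-rayThrough : ∀ {d x} (p : Path d x) ray → prefix (rayThrough p ray) x ≡ p
prefix-rayThrough {x = zero}  tt      ray = refl
prefix-rayThrough {x = suc x} (p , i) ray =
  cong₂ _,_ (trans (prefix-cong x earlier) (prefix-rayThrough p ray)) last
  where
  earlier : ∀ {k} → k < x → rayThrough (p , i) ray k ≡ rayThrough p ray k
  earlier {k} k<x with k ℕᵖ.≟ x
  ... | yes refl = contradiction k<x (ℕᵖ.<-irrefl refl)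
  ... | no  _    = refl
  last : rayThrough (p , i) ray x ≡ i
  last with x ℕᵖ.≟ x
  ... | yes refl = refl
  ... | no  x≢x  = contradiction refl x≢x

module _ {d h : ℕ} where
  open Int using (_+_; _*_; _-_)

  parentTerm-cong : {u w : ZV d h} → (∀ j → u j ≡ w j) → ∀ k → parentTerm u k ≡ parentTerm w k
  parentTerm-cong u≗w (vtx zero    _ _) = refl
  parentTerm-cong u≗w (vtx (suc _) _ _) = u≗w _

  childTerm-cong : {u w : ZV d h} → (∀ j → u j ≡ w j) → ∀ k → childTerm u k ≡ childTerm w k
  childTerm-cong u≗w (vtx x _ p) with x <? h
  ... | yes x<h = sumFin-cong (branch d x) (λ i → u≗w (vtx (suc x) x<h (p , i)))
  ... | no  _ = refl

  combo-cong : {u w : ZV d h} → (∀ j → u j ≡ w j) → ∀ k → combo u k ≡ combo w k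
  combo-cong u≗w k = cong₂ _-_ (cong₂ _-_ (cong (+ d *_) (u≗w k)) (parentTerm-cong u≗w k))
                                (childTerm-cong u≗w k)

  parentTerm-+ : ∀ (u w : ZV d h) k → parentTerm (λ j → u j + w j) k ≡ parentTerm u k + parentTerm w k
  parentTerm-+ u w (vtx zero    _ _) = refl
  parentTerm-+ u w (vtx (suc _) _ _) = refl

  childTerm-+ : ∀ (u w : ZV d h) k → childTerm (λ j → u j + w j) k ≡ childTerm u k + childTerm w k
  childTerm-+ u w (vtx x _ p) with x <? h
  ... | yes x<h = sumFin-+ (branch d x) (λ i → u (vtx (suc x) x<h (p , i))) (λ i → w (vtx (suc x) x<h (p , i)))
  ... | no  _ = refl

  combo-+ : ∀ (u w : ZV d h) k → combo (λ j → u j + w j) k ≡ combo u k + combo w k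
  combo-+ u w k rewrite parentTerm-+ u w k | childTerm-+ u w k =
    regroup (+ d) (u k) (w k) (parentTerm u k) (parentTerm w k) (childTerm u k) (childTerm w k)
    where
    regroup : ∀ δ x y p p' c c' →
      (δ * (x + y) - (p + p')) - (c + c') ≡ ((δ * x - p) - c) + ((δ * y - p') - c')
    regroup = ℤ-Solver.solve-∀

  parentTerm-* : ∀ a (u : ZV d h) k → parentTerm (λ j → a * u j) k ≡ a * parentTerm u k
  parentTerm-* a u (vtx zero    _ _) = sym (ℤᵖ.*-zeroʳ a)
  parentTerm-* a u (vtx (suc _) _ _) = refl

  childTerm-* : ∀ a (u : ZV d h) k → childTerm (λ j → a * u j) k ≡ a * childTerm u k
  childTerm-* a u (vtx x _ p) with x <? h
  ... | yes x<h = sumFin-*ˡ (branch d x) a (λ i → u (vtx (suc x) x<h (p , i)))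
  ... | no  _ = sym (ℤᵖ.*-zeroʳ a)

  combo-* : ∀ a (u : ZV d h) k → combo (λ j → a * u j) k ≡ a * combo u k
  combo-* a u k rewrite parentTerm-* a u k | childTerm-* a u k =
    factor (+ d) a (u k) (parentTerm u k) (childTerm u k)
    where
    factor : ∀ δ a x p c → (δ * (a * x) - a * p) - a * c ≡ a * ((δ * x - p) - c)
    factor = ℤ-Solver.solve-∀

  InL-cong : {u w : ZV d h} → (∀ j → u j ≡ w j) → InL u → InL w
  InL-cong u≗w (c , u≡c) = c , λ j → trans (sym (u≗w j)) (u≡c j)

  InL-combo : (c : ZV d h) → InL (combo c)
  InL-combo c = c , λ _ → refl

  InL-0 : InL {d} {h} (λ _ → + 0)
  InL-0 = (λ _ → + 0) , λ k → sym (combo-* (+ 0) (λ _ → + 0) k)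

  InL-+ : {u w : ZV d h} → InL u → InL w → InL (λ j → u j + w j)
  InL-+ (c , u≡c) (c' , w≡c') =
    (λ j → c j + c' j) , λ j → trans (cong₂ _+_ (u≡c j) (w≡c' j)) (sym (combo-+ c c' j))

  InL-* : ∀ a {u : ZV d h} → InL u → InL (λ j → a * u j)
  InL-* a (c , u≡c) = (λ j → a * c j) , λ j → trans (cong (a *_) (u≡c j)) (sym (combo-* a c j))

  InL-sumFin : ∀ n {H : Fin n → ZV d h} → (∀ i → InL (H i)) → InL (λ j → sumFin n (λ i → H i j))
  InL-sumFin zero    H∈L = InL-0
  InL-sumFin (suc n) H∈L = InL-+ (H∈L zero) (InL-sumFin n (H∈L ∘ suc))

  Annihilates-cong : ∀ {n} {u w : ZV d h} → (∀ j → u j ≡ w j) → Annihilates n u → Annihilates n w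
  Annihilates-cong {n} u≗w = InL-cong (λ j → cong (+ n *_) (u≗w j))

  Annihilates-0 : ∀ n → Annihilates {d} {h} n (λ _ → + 0)
  Annihilates-0 n = InL-cong (λ _ → sym (ℤᵖ.*-zeroʳ (+ n))) InL-0

  Annihilates-sumFin : ∀ {n} m {H : Fin m → ZV d h} → (∀ i → Annihilates n (H i)) →
    Annihilates n (λ j → sumFin m (λ i → H i j))
  Annihilates-sumFin {n} m {H} nH∈L =
    InL-cong (λ j → sumFin-*ˡ m (+ n) (λ i → H i j)) (InL-sumFin m nH∈L)

  Annihilates-childTerm : ∀ n (u : ZV d h) → Annihilates n u → Annihilates n (parentTerm u) →
    Annihilates n (childTerm u)
  Annihilates-childTerm n u nu∈L np∈L =
    InL-cong (λ k → solve-for-child (+ d) (+ n) (u k) (parentTerm u k) (childTerm u k))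
      (InL-+ (InL-+ (InL-* (+ d) nu∈L) (InL-* (- + 1) np∈L)) (InL-* (- + n) (InL-combo u)))
    where
    solve-for-child : ∀ δ ν x p c → δ * (ν * x) + (- + 1) * (ν * p) + (- ν) * ((δ * x - p) - c) ≡ ν * c
    solve-for-child = ℤ-Solver.solve-∀

  Annihilates-% : ∀ {a b} {v : ZV d h} .{{_ : NonZero b}} → Annihilates a v → Annihilates b v →
    Annihilates (a % b) v
  Annihilates-% {a} {b} {v} av∈L bv∈L =
    InL-cong (λ j → reduce (v j)) (InL-+ av∈L (InL-* (- + (a / b)) bv∈L))
    where
    a≡r+q*b : + a ≡ + (a % b) + + (a / b) * + b
    a≡r+q*b = trans (cong +_ (m≡m%n+[m/n]*n a b))
                    (trans (ℤᵖ.pos-+ (a % b) _) (cong (_+_ (+ (a % b))) (ℤᵖ.pos-* (a / b) b)))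
    cancel : ∀ r q b x → (r + q * b) * x + (- q) * (b * x) ≡ r * x
    cancel = ℤ-Solver.solve-∀
    reduce : ∀ x → + a * x + (- + (a / b)) * (+ b * x) ≡ + (a % b) * x
    reduce x = trans (cong (λ t → t * x + (- + (a / b)) * (+ b * x)) a≡r+q*b) (cancel (+ (a % b)) (+ (a / b)) (+ b) x)

  IsOrder-∣ : ∀ {v : ZV d h} {m a} → IsOrder v m → Annihilates a v → m ∣ a
  IsOrder-∣ {v} {m} {a} (m>0 , mv∈L , m-minimal) av∈L = by-remainder {{Nat.>-nonZero m>0}}
    where
    by-remainder : .{{_ : NonZero m}} → m ∣ a
    by-remainder with a % m ℕᵖ.≟ 0
    ... | yes a%m≡0 = m%n≡0⇒n∣m a m a%m≡0
    ... | no  a%m≢0 = contradiction (m-minimal (a % m) (ℕᵖ.n≢0⇒n>0 a%m≢0) (Annihilates-% av∈L mv∈L))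
                                    (ℕᵖ.<⇒≱ (m%n<n a m))

  childTerm-internal : ∀ {x} .(x≤h : x ≤ h) (p : Path d x) (x<h : x < h) (u : ZV d h) →
    childTerm u (vtx x x≤h p) ≡ sumFin (branch d x) (λ i → u (vtx (suc x) x<h (p , i)))
  childTerm-internal {x} _ p x<h u with x <? h
  ... | yes _   = refl
  ... | no  x≮h = contradiction x<h x≮h

  childTerm-leaf : ∀ {x} .(x≤h : x ≤ h) (p : Path d x) → ¬ x < h → (u : ZV d h) →
    childTerm u (vtx x x≤h p) ≡ + 0
  childTerm-leaf {x} _ p x≮h u with x <? h
  ... | yes x<h = contradiction x<h x≮h
  ... | no  _   = refl

  d*∣u∣≤∣parent∣+∣children∣ : (u : ZV d h) (j : Vertex d h) → combo u j ≡ + 0 →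
    d Nat.* ∣ u j ∣ ≤ ∣ parentTerm u j ∣ Nat.+ ∣ childTerm u j ∣
  d*∣u∣≤∣parent∣+∣children∣ u j combo≡0 = begin
    d Nat.* ∣ u j ∣                       ≡⟨ ℤᵖ.∣i*j∣≡∣i∣*∣j∣ (+ d) (u j) ⟨
    ∣ + d * u j ∣
      ≡⟨ cong ∣_∣ (solve-for-du (+ d * u j) (parentTerm u j) (childTerm u j) combo≡0) ⟩
    ∣ parentTerm u j + childTerm u j ∣    ≤⟨ ℤᵖ.∣i+j∣≤∣i∣+∣j∣ (parentTerm u j) (childTerm u j) ⟩
    ∣ parentTerm u j ∣ Nat.+ ∣ childTerm u j ∣ ∎
    where
    open ℕᵖ.≤-Reasoning
    solve-for-du : ∀ x p c → (x - p) - c ≡ + 0 → x ≡ p + c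
    solve-for-du x p c eq = trans (rearrange x p c) (trans (cong (_+ (p + c)) eq) (ℤᵖ.+-identityˡ _))
      where
      rearrange : ∀ x p c → x ≡ ((x - p) - c) + (p + c)
      rearrange = ℤ-Solver.solve-∀

  combo≡+ : ∀ (u : ZV d h) j {a b c e} → u j ≡ + a → parentTerm u j ≡ + b → childTerm u j ≡ + c →
    d Nat.* a ≡ b Nat.+ c Nat.+ e → combo u j ≡ + e
  combo≡+ u j {a} {b} {c} {e} uj≡a pj≡b cj≡c da≡b+c+e = begin
    combo u j                                   ≡⟨ cong₂ _-_ (cong₂ _-_ (cong (+ d *_) uj≡a) pj≡b) cj≡c ⟩
    (+ d * + a - + b) - + c                     ≡⟨ cong (λ t → (t - + b) - + c) (ℤᵖ.pos-* d a) ⟨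
    (+ (d Nat.* a) - + b) - + c                 ≡⟨ cong (λ t → (+ t - + b) - + c) da≡b+c+e ⟩
    (+ (b Nat.+ c Nat.+ e) - + b) - + c
      ≡⟨ cong (λ t → (t - + b) - + c) (trans (ℤᵖ.pos-+ (b Nat.+ c) e) (cong (_+ + e) (ℤᵖ.pos-+ b c))) ⟩
    ((+ b + + c) + + e - + b) - + c             ≡⟨ cancel (+ b) (+ c) (+ e) ⟩
    + e                                         ∎
    where
    open ≡-Reasoning
    cancel : ∀ x y z → ((x + y) + z - x) - y ≡ z
    cancel = ℤ-Solver.solve-∀

  combo-balanced : ∀ (u : ZV d h) j {a b c} → u j ≡ + a → parentTerm u j ≡ + b → childTerm u j ≡ + c →
    d Nat.* a ≡ b Nat.+ c → combo u j ≡ + 0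
  combo-balanced u j uj≡a pj≡b cj≡c da≡b+c =
    combo≡+ u j uj≡a pj≡b cj≡c (trans da≡b+c (sym (ℕᵖ.+-identityʳ _)))

module _ {d h : ℕ} where
  childTerm-basis : ∀ {x} .(x≤h : x ≤ h) (p : Path d x) z .(1+x≤h : suc x ≤ h) k →
    childTerm (basis (vtx (suc x) 1+x≤h (p , z))) k ≡ basis (vtx x x≤h p) k
  childTerm-basis {x} _ p z 1+x≤h (vtx y _ p′) with y <? h
  ... | yes _ = begin
    sumFin (branch d y) (λ i → indicator (eqPath d (p , z) (p′ , i)))
      ≡⟨ sumFin-cong (branch d y) (λ i → cong indicator (eqPath-sym (p , z) (p′ , i))) ⟩
    sumFin (branch d y) (λ i → indicator (eqPath d (p′ , i) (p , z)))
      ≡⟨ sumFin-child-indicator p′ p z ⟩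
    indicator (eqPath d p′ p)
      ≡⟨ cong indicator (eqPath-sym p′ p) ⟩
    indicator (eqPath d p p′) ∎
    where open ≡-Reasoning
  ... | no y≮h = sym (cong indicator (eqPath-depth p p′ (ℕᵖ.<⇒≢ x<y)))
    where
    x<y : x < y
    x<y = ℕᵖ.<-≤-trans (recompute (suc x Nat.≤? h) 1+x≤h) (ℕᵖ.≮⇒≥ y≮h)

  parentTerm-basis : ∀ {x} (p : Path d x) z .(1+x≤h : suc x ≤ h) (2+x≤h : suc (suc x) ≤ h) k →
    parentTerm (basis (vtx (suc x) 1+x≤h (p , z))) k ≡
    sumFin (branch d (suc x)) (λ i → basis (vtx (suc (suc x)) 2+x≤h ((p , z) , i)) k)
  parentTerm-basis {x} p z _ _ (vtx zero    _ tt)        = sym (sumFin-zero (branch d (suc x)) (λ _ → refl))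
  parentTerm-basis     p z _ _ (vtx (suc y) _ (p′ , i′)) = sym (sumFin-child-indicator (p , z) p′ i′)

  parentTerm-basis-leaf : ∀ {x} (p : Path d x) z .(1+x≤h : suc x ≤ h) → suc x ≡ h → ∀ k →
    parentTerm (basis (vtx (suc x) 1+x≤h (p , z))) k ≡ + 0
  parentTerm-basis-leaf p z _ 1+x≡h (vtx zero    _     tt)        = refl
  parentTerm-basis-leaf p z _ 1+x≡h (vtx (suc y) 1+y≤h (p′ , i′)) =
    cong indicator (eqPath-depth (p , z) p′
      (ℕᵖ.>⇒≢ (subst (y <_) (sym 1+x≡h) (recompute (suc y Nat.≤? h) 1+y≤h))))

module _ {d h : ℕ} where
  open Int using (_+_; _*_)

  sumPath : (x : ℕ) → (Path d x → ℤ) → ℤ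
  sumPath zero    F = F tt
  sumPath (suc x) F = sumPath x (λ p → sumFin (branch d x) (λ i → F (p , i)))

  sumDepth≤ : (x : ℕ) → .(x ≤ h) → (Vertex d h → ℤ) → ℤ
  sumDepth≤ zero    x≤h F = F (vtx 0 x≤h tt)
  sumDepth≤ (suc x) x≤h F = sumDepth≤ x (ℕᵖ.≤-trans (ℕᵖ.n≤1+n x) x≤h) F
                          + sumPath (suc x) (λ p → F (vtx (suc x) x≤h p))

  sumVertex : (Vertex d h → ℤ) → ℤ
  sumVertex = sumDepth≤ h ℕᵖ.≤-refl

  sumPath-cong : ∀ x {F G : Path d x → ℤ} → (∀ p → F p ≡ G p) → sumPath x F ≡ sumPath x G
  sumPath-cong zero    F≗G = F≗G tt
  sumPath-cong (suc x) F≗G = sumPath-cong x (λ p → sumFin-cong (branch d x) (λ i → F≗G (p , i)))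

  sumPath-zero : ∀ x {F : Path d x → ℤ} → (∀ p → F p ≡ + 0) → sumPath x F ≡ + 0
  sumPath-zero zero    F≗0 = F≗0 tt
  sumPath-zero (suc x) F≗0 = sumPath-zero x (λ p → sumFin-zero (branch d x) (λ i → F≗0 (p , i)))

  sumPath-select : ∀ x (F : Path d x → ℤ) (p₀ : Path d x) →
    sumPath x (λ p → F p * indicator (eqPath d p p₀)) ≡ F p₀
  sumPath-select zero    F tt        = ℤᵖ.*-identityʳ (F tt)
  sumPath-select (suc x) F (p₀ , i₀) = trans
    (sumPath-cong x (λ p → sumFin-select (branch d x) (eqPath d p p₀) i₀ (λ i → F (p , i))))
    (sumPath-select x (λ p → F (p , i₀)) p₀)

  sumPath-select-depth≢ : ∀ x {y} (F : Path d x → ℤ) (p₀ : Path d y) → x ≢ y →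
    sumPath x (λ p → F p * indicator (eqPath d p p₀)) ≡ + 0
  sumPath-select-depth≢ x F p₀ x≢y = sumPath-zero x λ p →
    trans (cong (λ b → F p * indicator b) (eqPath-depth p p₀ x≢y)) (ℤᵖ.*-zeroʳ (F p))

  sumDepth≤-select-< : ∀ x .(x≤h : x ≤ h) (F : Vertex d h → ℤ) {y} .(y≤h : y ≤ h) (p₀ : Path d y) →
    x < y → sumDepth≤ x x≤h (λ j → F j * basis j (vtx y y≤h p₀)) ≡ + 0
  sumDepth≤-select-< zero    0≤h F _ p₀ 0<y = trans
    (cong (λ b → F (vtx 0 0≤h tt) * indicator b) (eqPath-depth tt p₀ (ℕᵖ.<⇒≢ 0<y)))
    (ℤᵖ.*-zeroʳ (F (vtx 0 0≤h tt)))
  sumDepth≤-select-< (suc x) x≤h F y≤h p₀ x<y = cong₂ _+_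
    (sumDepth≤-select-< x _ F y≤h p₀ (ℕᵖ.<-trans (ℕᵖ.n<1+n x) x<y))
    (sumPath-select-depth≢ (suc x) (λ p → F (vtx (suc x) x≤h p)) p₀ (ℕᵖ.<⇒≢ x<y))

  sumDepth≤-select : ∀ x .(x≤h : x ≤ h) (F : Vertex d h → ℤ) {y} .(y≤h : y ≤ h) (p₀ : Path d y) →
    y ≤ x → sumDepth≤ x x≤h (λ j → F j * basis j (vtx y y≤h p₀)) ≡ F (vtx y y≤h p₀)
  sumDepth≤-select zero    _ F _ tt Nat.z≤n = ℤᵖ.*-identityʳ _
  sumDepth≤-select (suc x) x≤h F {y} y≤h p₀ y≤1+x with y ℕᵖ.≟ suc x
  ... | yes refl = trans
    (cong₂ _+_ (sumDepth≤-select-< x _ F y≤h p₀ (ℕᵖ.n<1+n x))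
               (sumPath-select (suc x) (λ p → F (vtx (suc x) x≤h p)) p₀))
    (ℤᵖ.+-identityˡ _)
  ... | no y≢1+x = trans
    (cong₂ _+_ (sumDepth≤-select x _ F y≤h p₀ (ℕᵖ.≤-pred (ℕᵖ.≤∧≢⇒< y≤1+x y≢1+x)))
               (sumPath-select-depth≢ (suc x) (λ p → F (vtx (suc x) x≤h p)) p₀ (y≢1+x ∘ sym)))
    (ℤᵖ.+-identityʳ _)

  sumVertex-select : (F : Vertex d h → ℤ) (k : Vertex d h) → sumVertex (λ j → F j * basis j k) ≡ F k
  sumVertex-select F (vtx y y≤h p₀) = sumDepth≤-select h _ F _ p₀ (recompute (y Nat.≤? h) y≤h)

  InL-sumPath : ∀ x {H : Path d x → ZV d h} → (∀ p → InL (H p)) → InL (λ k → sumPath x (λ p → H p k))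
  InL-sumPath zero    H∈L = H∈L tt
  InL-sumPath (suc x) H∈L = InL-sumPath x (λ p → InL-sumFin (branch d x) (λ i → H∈L (p , i)))

  InL-sumDepth≤ : ∀ x .(x≤h : x ≤ h) {H : Vertex d h → ZV d h} → (∀ j → InL (H j)) →
    InL (λ k → sumDepth≤ x x≤h (λ j → H j k))
  InL-sumDepth≤ zero    _ H∈L = H∈L _
  InL-sumDepth≤ (suc x) _ H∈L = InL-+ (InL-sumDepth≤ x _ H∈L) (InL-sumPath (suc x) (λ p → H∈L _))

  InL-sumVertex : {H : Vertex d h → ZV d h} → (∀ j → InL (H j)) → InL (λ k → sumVertex (λ j → H j k))
  InL-sumVertex = InL-sumDepth≤ h _

suc-∸ : ∀ {m n} → m ≤ n → suc n Nat.∸ m ≡ suc (n Nat.∸ m)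
suc-∸ = ℕᵖ.+-∸-assoc 1

*-pos : ∀ {m n} → 0 < m → 0 < n → 0 < m Nat.* n
*-pos {suc _} {suc _} _ _ = z<s

∣-*-gcd : ∀ {N m a b} → N ∣ m Nat.* a → N ∣ m Nat.* b → N ∣ m Nat.* gcd a b
∣-*-gcd {N} {m} {a} {b} N∣ma N∣mb =
  subst (N ∣_) (sym (c*gcd[m,n]≡gcd[cm,cn] m a b)) (gcd-greatest N∣ma N∣mb)

gcdUpTo : ℕ → (ℕ → ℕ) → ℕ
gcdUpTo zero    f = f 0
gcdUpTo (suc n) f = gcd (gcdUpTo n f) (f (suc n))

gcdUpTo-∣ : ∀ n f {i} → i ≤ n → gcdUpTo n f ∣ f i
gcdUpTo-∣ zero    f z≤n = ∣-refl
gcdUpTo-∣ (suc n) f {i} i≤1+n with i ℕᵖ.≟ suc n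
... | yes refl = gcd[m,n]∣n (gcdUpTo n f) (f (suc n))
... | no  i≢1+n = ∣-trans (gcd[m,n]∣m (gcdUpTo n f) (f (suc n)))
                          (gcdUpTo-∣ n f (ℕᵖ.≤-pred (ℕᵖ.≤∧≢⇒< i≤1+n i≢1+n)))

∣-*-gcdUpTo : ∀ n f {N m} → (∀ {i} → i ≤ n → N ∣ m Nat.* f i) → N ∣ m Nat.* gcdUpTo n f
∣-*-gcdUpTo zero    f         N∣mf = N∣mf z≤n
∣-*-gcdUpTo (suc n) f {N} {m} N∣mf = ∣-*-gcd {N} {m}
  (∣-*-gcdUpTo n f {N} {m} (λ i≤n → N∣mf (ℕᵖ.m≤n⇒m≤1+n i≤n))) (N∣mf ℕᵖ.≤-refl)

pos*≤0⇒≡0 : ∀ {a b} → 0 < a → a Nat.* b ≤ 0 → b ≡ 0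
pos*≤0⇒≡0 {suc a} {b} _ ab≤0 = ℕᵖ.n≤0⇒n≡0 (ℕᵖ.≤-trans (ℕᵖ.m≤m+n b (a Nat.* b)) ab≤0)

+*≡+⇒∣ : ∀ a b c → + a Int.* c ≡ + b → a ∣ b
+*≡+⇒∣ a b c ac≡b = divides ∣ c ∣ (begin
  b               ≡⟨ cong ∣_∣ ac≡b ⟨
  ∣ + a Int.* c ∣ ≡⟨ ℤᵖ.∣i*j∣≡∣i∣*∣j∣ (+ a) c ⟩
  a Nat.* ∣ c ∣   ≡⟨ ℕᵖ.*-comm a ∣ c ∣ ⟩
  ∣ c ∣ Nat.* a   ∎)
  where open ≡-Reasoning

module Coefficients (q₀ h' : ℕ) where
  open Nat using (_+_; _*_; _∸_; _^_)

  q d h : ℕ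
  q = suc q₀
  d = suc q
  h = suc h'

  repunit : ℕ → ℕ
  repunit zero    = 0
  repunit (suc s) = repunit s + q ^ s

  Ψ : ℕ → ℕ
  Ψ y = repunit (suc h ∸ y)

  Ψ-recurrence : ∀ {y} → y < h → d * Ψ (suc y) ≡ Ψ y + q * Ψ (suc (suc y))
  Ψ-recurrence {y} y<h rewrite suc-∸ (ℕᵖ.<⇒≤ y<h) | suc-∸ y<h =
    expand q (repunit (h ∸ suc y)) (q ^ (h ∸ suc y))
    where
    expand : ∀ q r t → suc q * (r + t) ≡ (r + t + q * t) + q * r
    expand = ℕ-Solver.solve-∀

  Ψ-below-leaves : Ψ (suc h) ≡ 0
  Ψ-below-leaves = cong repunit (ℕᵖ.n∸n≡0 h)

  Ψ-leaf : Ψ h ≡ 1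
  Ψ-leaf = cong repunit (ℕᵖ.m+n∸n≡m 1 h)

  Ψ-above-leaf : Ψ h' ≡ d
  Ψ-above-leaf = trans (cong repunit (ℕᵖ.m+n∸n≡m 2 h')) (cong suc (ℕᵖ.*-identityʳ q))

  Ψ-pos : ∀ {y} → y ≤ h → 0 < Ψ y
  Ψ-pos {y} y≤h rewrite suc-∸ y≤h =
    ℕᵖ.≤-trans (ℕᵖ.m^n>0 q (h ∸ y)) (ℕᵖ.m≤n+m (q ^ (h ∸ y)) (repunit (h ∸ y)))

  repunitProduct : ℕ → ℕ
  repunitProduct zero    = 1
  repunitProduct (suc n) = repunitProduct n * repunit (suc n)

  -- Ψ-prefix k = Ψ 0 ⋯ Ψ (k − 1) and Ψ-suffix m = Ψ (m + 1) ⋯ Ψ h.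
  Ψ-prefix : ℕ → ℕ
  Ψ-prefix zero    = 1
  Ψ-prefix (suc k) = Ψ-prefix k * Ψ k

  Ψ-suffix : ℕ → ℕ
  Ψ-suffix m = repunitProduct (h ∸ m)

  Ψ-suffix-step : ∀ {m} → m < h → Ψ-suffix m ≡ Ψ-suffix (suc m) * Ψ (suc m)
  Ψ-suffix-step m<h rewrite suc-∸ m<h = refl

  -- Δ k is q^h d times the product of all Ψ i except Ψ k and Ψ (k + 1): exactly what makes
  -- Γ (meet) · Ψ (depth) balanced at the vertices of the ray (Δ-root, Δ-step).
  Δ : ℕ → ℕ
  Δ k = q ^ h * d * Ψ-prefix k * Ψ-suffix (suc k)

  Γ : ℕ → ℕ
  Γ zero    = Ψ-suffix 0
  Γ (suc k) = Γ k + Δ k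

  D : ℕ
  D = Δ h' * Ψ h'

  Δ-root : Δ 0 * Ψ 1 ≡ q ^ h * d * Γ 0
  Δ-root rewrite Ψ-suffix-step {0} z<s = regroup (q ^ h * d) (Ψ-suffix 1) (Ψ 1)
    where
    regroup : ∀ r s t → r * 1 * s * t ≡ r * (s * t)
    regroup = ℕ-Solver.solve-∀

  Δ-step : ∀ {y} → suc y < h → Δ (suc y) * Ψ (suc (suc y)) ≡ Δ y * Ψ y
  Δ-step {y} 1+y<h rewrite Ψ-suffix-step 1+y<h =
    regroup (q ^ h * d) (Ψ-prefix y) (Ψ y) (Ψ-suffix (suc (suc y))) (Ψ (suc (suc y)))
    where
    regroup : ∀ r a b c e → r * (a * b) * c * e ≡ r * a * (c * e) * b
    regroup = ℕ-Solver.solve-∀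

  open ≡-Reasoning

  balance-root : d * (Γ 0 * Ψ 0) ≡ Γ 1 * Ψ 1 + q * (Γ 0 * Ψ 1)
  balance-root = begin
    d * (Γ 0 * Ψ 0)
      ≡⟨ expand q (Γ 0) (Ψ 1) (q ^ h) ⟩
    Γ 0 * Ψ 1 + q ^ h * d * Γ 0 + q * (Γ 0 * Ψ 1)
      ≡⟨ cong (λ t → Γ 0 * Ψ 1 + t + q * (Γ 0 * Ψ 1)) Δ-root ⟨
    Γ 0 * Ψ 1 + Δ 0 * Ψ 1 + q * (Γ 0 * Ψ 1)
      ≡⟨ cong (_+ q * (Γ 0 * Ψ 1)) (ℕᵖ.*-distribʳ-+ (Ψ 1) (Γ 0) (Δ 0)) ⟨
    Γ 1 * Ψ 1 + q * (Γ 0 * Ψ 1) ∎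
    where
    expand : ∀ q a b t → suc q * (a * (b + t)) ≡ a * b + t * suc q * a + q * (a * b)
    expand = ℕ-Solver.solve-∀

  balance-ray : ∀ {y} → suc y < h → d * (Γ (suc y) * Ψ (suc y)) ≡
    Γ y * Ψ y + (Γ (suc (suc y)) * Ψ (suc (suc y)) + q₀ * (Γ (suc y) * Ψ (suc (suc y))))
  balance-ray {y} 1+y<h = begin
    d * (Γ (suc y) * Ψ (suc y))
      ≡⟨ ℕ*.x∙yz≈y∙xz d (Γ (suc y)) (Ψ (suc y)) ⟩
    (Γ y + Δ y) * (d * Ψ (suc y))
      ≡⟨ cong ((Γ y + Δ y) *_) (Ψ-recurrence (ℕᵖ.<-trans (ℕᵖ.n<1+n y) 1+y<h)) ⟩
    (Γ y + Δ y) * (Ψ y + q * Ψ (suc (suc y)))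
      ≡⟨ expand q (Γ y) (Δ y) (Ψ y) (Ψ (suc (suc y))) ⟩
    Γ y * Ψ y + Δ y * Ψ y + q * ((Γ y + Δ y) * Ψ (suc (suc y)))
      ≡⟨ cong (λ t → Γ y * Ψ y + t + q * ((Γ y + Δ y) * Ψ (suc (suc y)))) (sym (Δ-step 1+y<h)) ⟩
    Γ y * Ψ y + Δ (suc y) * Ψ (suc (suc y)) + q * ((Γ y + Δ y) * Ψ (suc (suc y)))
      ≡⟨ collect q₀ (Γ y * Ψ y) (Γ y + Δ y) (Δ (suc y)) (Ψ (suc (suc y))) ⟩
    Γ y * Ψ y + (Γ (suc (suc y)) * Ψ (suc (suc y)) + q₀ * (Γ (suc y) * Ψ (suc (suc y)))) ∎
    where
    expand : ∀ q a b c e → (a + b) * (c + q * e) ≡ a * c + b * c + q * ((a + b) * e)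
    expand = ℕ-Solver.solve-∀
    collect : ∀ q₀ x g δ e → x + δ * e + suc q₀ * (g * e) ≡ x + ((g + δ) * e + q₀ * (g * e))
    collect = ℕ-Solver.solve-∀

  balance-leaf : d * (Γ h * Ψ h) ≡ Γ h' * Ψ h' + D
  balance-leaf rewrite Ψ-leaf | Ψ-above-leaf = expand d (Γ h') (Δ h')
    where
    expand : ∀ d a b → d * ((a + b) * 1) ≡ a * d + b * d
    expand = ℕ-Solver.solve-∀

  balance-off : ∀ k {y} → y < h → d * (Γ k * Ψ (suc y)) ≡ Γ k * Ψ y + q * (Γ k * Ψ (suc (suc y)))
  balance-off k {y} y<h = begin
    d * (Γ k * Ψ (suc y))               ≡⟨ ℕ*.x∙yz≈y∙xz d (Γ k) (Ψ (suc y)) ⟩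
    Γ k * (d * Ψ (suc y))               ≡⟨ cong (Γ k *_) (Ψ-recurrence y<h) ⟩
    Γ k * (Ψ y + q * Ψ (suc (suc y)))   ≡⟨ ℕᵖ.*-distribˡ-+ (Γ k) (Ψ y) _ ⟩
    Γ k * Ψ y + Γ k * (q * Ψ (suc (suc y))) ≡⟨ cong (_+_ (Γ k * Ψ y)) (ℕ*.x∙yz≈y∙xz (Γ k) q _) ⟩
    Γ k * Ψ y + q * (Γ k * Ψ (suc (suc y))) ∎

  balance-off-leaf : ∀ k → d * (Γ k * Ψ h) ≡ Γ k * Ψ h'
  balance-off-leaf k = begin
    d * (Γ k * Ψ h)                       ≡⟨ balance-off k (ℕᵖ.n<1+n h') ⟩
    Γ k * Ψ h' + q * (Γ k * Ψ (suc h))    ≡⟨ cong (λ t → Γ k * Ψ h' + q * (Γ k * t)) Ψ-below-leaves ⟩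
    Γ k * Ψ h' + q * (Γ k * 0)            ≡⟨ cong (λ t → Γ k * Ψ h' + q * t) (ℕᵖ.*-zeroʳ (Γ k)) ⟩
    Γ k * Ψ h' + q * 0                    ≡⟨ cong (_+_ (Γ k * Ψ h')) (ℕᵖ.*-zeroʳ q) ⟩
    Γ k * Ψ h' + 0                        ≡⟨ ℕᵖ.+-identityʳ _ ⟩
    Γ k * Ψ h'                            ∎

  repunitProduct-pos : ∀ n → 0 < repunitProduct n
  repunitProduct-pos zero    = z<s
  repunitProduct-pos (suc n) =
    *-pos (repunitProduct-pos n) (ℕᵖ.≤-trans (ℕᵖ.m^n>0 q n) (ℕᵖ.m≤n+m (q ^ n) (repunit n)))

  Ψ-prefix-pos : ∀ {k} → k ≤ suc h → 0 < Ψ-prefix k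
  Ψ-prefix-pos {zero}  _         = z<s
  Ψ-prefix-pos {suc k} (s≤s k≤h) = *-pos (Ψ-prefix-pos (ℕᵖ.m≤n⇒m≤1+n k≤h)) (Ψ-pos k≤h)

  D-pos : 0 < D
  D-pos = *-pos (*-pos (*-pos (*-pos (ℕᵖ.m^n>0 q h) z<s) (Ψ-prefix-pos (ℕᵖ.m≤n⇒m≤1+n (ℕᵖ.n≤1+n h'))))
                       (repunitProduct-pos (h ∸ h)))
                (Ψ-pos (ℕᵖ.n≤1+n h'))

  g : ℕ
  g = gcd D (gcdUpTo h (λ y → gcdUpTo y (λ k → Γ k * Ψ y)))

  g∣D : g ∣ D
  g∣D = gcd[m,n]∣m D _

  g∣ΓΨ : ∀ {k y} → k ≤ y → y ≤ h → g ∣ Γ k * Ψ y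
  g∣ΓΨ {k} {y} k≤y y≤h = ∣-trans (gcd[m,n]∣n D _)
    (∣-trans (gcdUpTo-∣ h (λ y → gcdUpTo y (λ k → Γ k * Ψ y)) y≤h) (gcdUpTo-∣ y (λ k → Γ k * Ψ y) k≤y))

  ∣-*-g : ∀ {N m} → N ∣ m * D → (∀ {k y} → k ≤ y → y ≤ h → N ∣ m * (Γ k * Ψ y)) → N ∣ m * g
  ∣-*-g {N} {m} N∣mD N∣mΓΨ = ∣-*-gcd {N} {m} N∣mD
    (∣-*-gcdUpTo h _ {N} {m} (λ {y} y≤h → ∣-*-gcdUpTo y _ {N} {m} (λ k≤y → N∣mΓΨ k≤y y≤h)))

  g≢0 : g ≢ 0
  g≢0 = gcd[m,n]≢0 D _ (inj₁ (ℕᵖ.>⇒≢ D-pos))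

  leafOrder : ℕ
  leafOrder = quotient g∣D

  D≡leafOrder*g : D ≡ leafOrder * g
  D≡leafOrder*g = _∣_.equality g∣D

  leafOrder-pos : 0 < leafOrder
  leafOrder-pos = ℕᵖ.n≢0⇒n>0 λ order≡0 → ℕᵖ.>⇒≢ D-pos (trans D≡leafOrder*g (cong (_* g) order≡0))

module Nonsingular (q₀ h' : ℕ) where
  open Coefficients q₀ h'
  open Nat using (_+_; _*_; _∸_; _^_)
  open ℕᵖ.≤-Reasoning

  decay-step : ∀ {y a b c} → y < h → d * a ≤ b + c → Ψ (suc y) * c ≤ q * (Ψ (suc (suc y)) * a) →
    Ψ y * a ≤ Ψ (suc y) * b
  decay-step {y} {a} {b} {c} y<h da≤b+c Ψc≤qΨa = ℕᵖ.+-cancelʳ-≤ (q * (Ψ (suc (suc y)) * a)) _ _ (begin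
    Ψ y * a + q * (Ψ (suc (suc y)) * a)       ≡⟨ weigh ⟨
    Ψ (suc y) * (d * a)                       ≤⟨ ℕᵖ.*-monoʳ-≤ (Ψ (suc y)) da≤b+c ⟩
    Ψ (suc y) * (b + c)                       ≡⟨ ℕᵖ.*-distribˡ-+ (Ψ (suc y)) b c ⟩
    Ψ (suc y) * b + Ψ (suc y) * c             ≤⟨ ℕᵖ.+-monoʳ-≤ (Ψ (suc y) * b) Ψc≤qΨa ⟩
    Ψ (suc y) * b + q * (Ψ (suc (suc y)) * a) ∎)
    where
    weigh : Ψ (suc y) * (d * a) ≡ Ψ y * a + q * (Ψ (suc (suc y)) * a)
    weigh = begin-equality
      Ψ (suc y) * (d * a)                   ≡⟨ ℕᵖ.*-assoc (Ψ (suc y)) d a ⟨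
      Ψ (suc y) * d * a                     ≡⟨ cong (_* a) (trans (ℕᵖ.*-comm (Ψ (suc y)) d) (Ψ-recurrence y<h)) ⟩
      (Ψ y + q * Ψ (suc (suc y))) * a       ≡⟨ ℕᵖ.*-distribʳ-+ a (Ψ y) _ ⟩
      Ψ y * a + q * Ψ (suc (suc y)) * a     ≡⟨ cong (_+_ (Ψ y * a)) (ℕᵖ.*-assoc q (Ψ (suc (suc y))) a) ⟩
      Ψ y * a + q * (Ψ (suc (suc y)) * a)   ∎

  module _ (u : ZV d h) (combo≡0 : ∀ j → combo u j ≡ + 0) where
    decay : ∀ t {y} .(1+y≤h : suc y ≤ h) (p : Path d y) (i : Fin (branch d y)) → suc y + t ≡ h →
      Ψ y * ∣ u (vtx (suc y) 1+y≤h (p , i)) ∣ ≤ Ψ (suc y) * ∣ parentTerm u (vtx (suc y) 1+y≤h (p , i)) ∣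
    children-bound : ∀ t {y} .(1+y≤h : suc y ≤ h) (p : Path d y) (i : Fin (branch d y)) → suc y + t ≡ h →
      Ψ (suc y) * ∣ childTerm u (vtx (suc y) 1+y≤h (p , i)) ∣ ≤
      q * (Ψ (suc (suc y)) * ∣ u (vtx (suc y) 1+y≤h (p , i)) ∣)

    decay t {y} 1+y≤h p i y+t≡h =
      decay-step (subst (suc y ≤_) y+t≡h (ℕᵖ.m≤m+n (suc y) t))
                 (d*∣u∣≤∣parent∣+∣children∣ u _ (combo≡0 _)) (children-bound t 1+y≤h p i y+t≡h)

    children-bound zero {y} 1+y≤h p i y+0≡h
      rewrite childTerm-leaf 1+y≤h (p , i) (ℕᵖ.<-irrefl (trans (sym (ℕᵖ.+-identityʳ (suc y))) y+0≡h)) u =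
      ℕᵖ.≤-trans (ℕᵖ.≤-reflexive (ℕᵖ.*-zeroʳ (Ψ (suc y)))) z≤n
    children-bound (suc t) {y} 1+y≤h p i y+1+t≡h = ℕᵖ.≤-trans
      (ℕᵖ.≤-reflexive (cong (λ c → Ψ (suc y) * ∣ c ∣) (childTerm-internal 1+y≤h (p , i) 2+y≤h u)))
      (K*∣sumFin∣≤n*B q (Ψ (suc y)) (Ψ (suc (suc y)) * ∣ u (vtx (suc y) 1+y≤h (p , i)) ∣)
         (λ i′ → u (vtx (suc (suc y)) 2+y≤h ((p , i) , i′))) (λ i′ → decay t 2+y≤h (p , i) i′ 2+y+t≡h))
      where
      2+y+t≡h : suc (suc y) + t ≡ h
      2+y+t≡h = trans (sym (ℕᵖ.+-suc (suc y) t)) y+1+t≡h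
      2+y≤h : suc (suc y) ≤ h
      2+y≤h = subst (suc (suc y) ≤_) 2+y+t≡h (ℕᵖ.m≤m+n (suc (suc y)) t)

    root : Vertex d h
    root = vtx 0 z≤n tt

    root-zero : u root ≡ + 0
    root-zero = ℤᵖ.∣i∣≡0⇒i≡0 (pos*≤0⇒≡0 {d} z<s (ℕᵖ.≤-reflexive
                  (pos*≤0⇒≡0 (ℕᵖ.m^n>0 q h) (ℕᵖ.+-cancelˡ-≤ (Ψ 1 * (d * a)) _ 0 (begin
      Ψ 1 * (d * a) + q ^ h * (d * a)   ≡⟨ ℕᵖ.*-distribʳ-+ (d * a) (Ψ 1) (q ^ h) ⟨
      Ψ 0 * (d * a)                     ≤⟨ ℕᵖ.*-monoʳ-≤ (Ψ 0) da≤∣Σ∣ ⟩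
      Ψ 0 * ∣ children ∣                ≤⟨ K*∣sumFin∣≤n*B d (Ψ 0) (Ψ 1 * a) child (λ i → decay h' z<s tt i refl) ⟩
      d * (Ψ 1 * a)                     ≡⟨ ℕ*.x∙yz≈y∙xz d (Ψ 1) a ⟩
      Ψ 1 * (d * a)                     ≡⟨ ℕᵖ.+-identityʳ _ ⟨
      Ψ 1 * (d * a) + 0                 ∎)))))
      where
      a : ℕ
      a = ∣ u root ∣
      child : Fin d → ℤ
      child i = u (vtx 1 z<s (tt , i))
      children : ℤ
      children = sumFin d child
      da≤∣Σ∣ : d * a ≤ ∣ children ∣
      da≤∣Σ∣ = subst (λ c → d * a ≤ ∣ c ∣) (childTerm-internal z≤n tt z<s u)
                     (d*∣u∣≤∣parent∣+∣children∣ u root (combo≡0 root))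

    zero-at-depth : ∀ x .(x≤h : x ≤ h) (p : Path d x) → u (vtx x x≤h p) ≡ + 0
    zero-at-depth zero    _     tt      = root-zero
    zero-at-depth (suc y) 1+y≤h (p , i) =
      ℤᵖ.∣i∣≡0⇒i≡0 (pos*≤0⇒≡0 (Ψ-pos (ℕᵖ.<⇒≤ 1+y≤h′)) (begin
      Ψ y * ∣ u (vtx (suc y) 1+y≤h (p , i)) ∣  ≤⟨ decay (h ∸ suc y) 1+y≤h p i (ℕᵖ.m+[n∸m]≡n 1+y≤h′) ⟩
      Ψ (suc y) * ∣ u (vtx y _ p) ∣           ≡⟨ cong (λ v → Ψ (suc y) * ∣ v ∣) (zero-at-depth y _ p) ⟩
      Ψ (suc y) * 0                           ≡⟨ ℕᵖ.*-zeroʳ (Ψ (suc y)) ⟩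
      0                                       ∎))
      where
      1+y≤h′ : suc y ≤ h
      1+y≤h′ = recompute (suc y Nat.≤? h) 1+y≤h

  combo≡0⇒≡0 : (u : ZV d h) → (∀ j → combo u j ≡ + 0) → ∀ j → u j ≡ + 0
  combo≡0⇒≡0 u combo≡0 (vtx x x≤h p) = zero-at-depth u combo≡0 x x≤h p

module Green (q₀ h' : ℕ) (ray : Ray (suc (suc q₀))) where
  open Coefficients q₀ h'
  open Nat using (_+_; _*_)

  onRay : ∀ {x} → Path d x → Bool
  onRay {x} p = eqPath d p (prefix ray x)

  meet : ∀ {x} → Path d x → ℕ
  meet {zero}  _       = 0
  meet {suc x} (p , i) = if onRay (p , i) then suc x else meet p

  green : ZV d h
  green (vtx x _ p) = + (Γ (meet p) * Ψ x)

  rayLeaf : Vertex d h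
  rayLeaf = vtx h ℕᵖ.≤-refl (prefix ray h)

  onRay-parent : ∀ {x} (p : Path d x) i → onRay (p , i) ≡ true → onRay p ≡ true
  onRay-parent p i = ∧-conicalˡ (onRay p) _

  meet-onRay : ∀ {x} (p : Path d x) → onRay p ≡ true → meet p ≡ x
  meet-onRay {zero}  _       _  = refl
  meet-onRay {suc x} (p , i) on = cong (λ b → if b then suc x else meet p) on

  meet-offRay : ∀ {x} (p : Path d x) i → onRay (p , i) ≡ false → meet (p , i) ≡ meet p
  meet-offRay {x} p i off = cong (λ b → if b then suc x else meet p) off

  meet-child-onRay : ∀ {x} (p : Path d x) i → onRay p ≡ true →
    meet (p , i) ≡ (if toℕ i ≡ᵇ toℕ (ray x) then suc x else x)
  meet-child-onRay {x} p i on rewrite on = cong (λ m → if toℕ i ≡ᵇ toℕ (ray x) then suc x else m) (meet-onRay p on)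

  basis-rayLeaf : ∀ .(h≤h : h ≤ h) (p : Path d h) → basis rayLeaf (vtx h h≤h p) ≡ indicator (onRay p)
  basis-rayLeaf _ p = cong indicator (eqPath-sym (prefix ray h) p)

  basis-rayLeaf-shallow : ∀ {x} .(x≤h : x ≤ h) (p : Path d x) → x < h → basis rayLeaf (vtx x x≤h p) ≡ + 0
  basis-rayLeaf-shallow _ p x<h = cong indicator (eqPath-depth (prefix ray h) p (ℕᵖ.>⇒≢ x<h))

  green-balanced-root : combo green (vtx 0 z≤n tt) ≡ + 0
  green-balanced-root = combo-balanced green (vtx 0 z≤n tt) refl refl
    (trans (childTerm-internal z≤n tt z<s green) (sumFin-split q (ray 0) (λ c → Γ (if c then 1 else 0) * Ψ 1)))
    balance-root

  green-balanced-interior : ∀ {y} .(1+y≤h : suc y ≤ h) (p : Path d y) i → suc y < h →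
    combo green (vtx (suc y) 1+y≤h (p , i)) ≡ + 0
  green-balanced-interior {y} 1+y≤h p i 1+y<h = by-onRay (onRay (p , i)) refl
    where
    by-onRay : ∀ b → onRay (p , i) ≡ b → combo green (vtx (suc y) 1+y≤h (p , i)) ≡ + 0
    by-onRay true on = combo-balanced green (vtx (suc y) 1+y≤h (p , i))
      (cong (λ m → + (Γ m * Ψ (suc y))) (meet-onRay (p , i) on))
      (cong (λ m → + (Γ m * Ψ y)) (meet-onRay p (onRay-parent p i on)))
      (trans (childTerm-internal 1+y≤h (p , i) 1+y<h green)
        (trans (sumFin-cong q (λ i′ → cong (λ m → + (Γ m * Ψ (suc (suc y)))) (meet-child-onRay (p , i) i′ on)))
               (sumFin-split q₀ (ray (suc y)) (λ c → Γ (if c then suc (suc y) else suc y) * Ψ (suc (suc y))))))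
      (balance-ray 1+y<h)
    by-onRay false on = combo-balanced green (vtx (suc y) 1+y≤h (p , i))
      (cong (λ m → + (Γ m * Ψ (suc y))) (meet-offRay p i on))
      refl
      (trans (childTerm-internal 1+y≤h (p , i) 1+y<h green)
        (trans (sumFin-cong q (λ i′ → cong (λ m → + (Γ m * Ψ (suc (suc y))))
                                           (trans (meet-offRay (p , i) i′ (cong (_∧ _) on)) (meet-offRay p i on))))
               (sumFin-const q (Γ (meet p) * Ψ (suc (suc y))))))
      (balance-off (meet p) (ℕᵖ.<-trans (ℕᵖ.n<1+n y) 1+y<h))

  green-leaf : ∀ .(h≤h : h ≤ h) (p : Path d h') i →
    combo green (vtx h h≤h (p , i)) ≡ + D Int.* indicator (onRay (p , i))
  green-leaf h≤h p i = by-onRay (onRay (p , i)) refl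
    where
    by-onRay : ∀ b → onRay (p , i) ≡ b → combo green (vtx h h≤h (p , i)) ≡ + D Int.* indicator b
    by-onRay true on = trans
      (combo≡+ green (vtx h h≤h (p , i))
        (cong (λ m → + (Γ m * Ψ h)) (meet-onRay (p , i) on))
        (cong (λ m → + (Γ m * Ψ h')) (meet-onRay p (onRay-parent p i on)))
        (childTerm-leaf h≤h (p , i) (ℕᵖ.<-irrefl refl) green)
        (trans balance-leaf (cong (_+ D) (sym (ℕᵖ.+-identityʳ (Γ h' * Ψ h'))))))
      (sym (ℤᵖ.*-identityʳ (+ D)))
    by-onRay false on = trans
      (combo-balanced green (vtx h h≤h (p , i))
        (cong (λ m → + (Γ m * Ψ h)) (meet-offRay p i on))
        refl
        (childTerm-leaf h≤h (p , i) (ℕᵖ.<-irrefl refl) green)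
        (trans (balance-off-leaf (meet p)) (sym (ℕᵖ.+-identityʳ _))))
      (sym (ℤᵖ.*-zeroʳ (+ D)))

  combo-green : ∀ j → combo green j ≡ + D Int.* basis rayLeaf j
  combo-green (vtx zero 0≤h tt) =
    trans green-balanced-root (sym (trans (cong (+ D Int.*_) (basis-rayLeaf-shallow 0≤h tt z<s)) (ℤᵖ.*-zeroʳ (+ D))))
  combo-green (vtx (suc y) 1+y≤h (p , i)) =
    by-depth (ℕᵖ.m≤n⇒m<n∨m≡n (recompute (suc y Nat.≤? h) 1+y≤h)) 1+y≤h p i
    where
    by-depth : ∀ {y} → suc y < h ⊎ suc y ≡ h → ∀ .(1+y≤h : suc y ≤ h) (p : Path d y) i →
      combo green (vtx (suc y) 1+y≤h (p , i)) ≡ + D Int.* basis rayLeaf (vtx (suc y) 1+y≤h (p , i))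
    by-depth (inj₁ 1+y<h) 1+y≤h p i = trans (green-balanced-interior 1+y≤h p i 1+y<h)
      (sym (trans (cong (+ D Int.*_) (basis-rayLeaf-shallow 1+y≤h (p , i) 1+y<h)) (ℤᵖ.*-zeroʳ (+ D))))
    by-depth (inj₂ refl) h≤h p i =
      trans (green-leaf h≤h p i) (cong (+ D Int.*_) (sym (basis-rayLeaf h≤h (p , i))))

-- With d ≥ 3 every internal vertex has a second child off the ray, so every value Γ k · Ψ y
-- (k ≤ y ≤ h) is taken by green (green-realizes).
module LeafOrder (e h' : ℕ) (ray : Ray (suc (suc (suc e)))) where
  open Coefficients (suc e) h'
  open Green (suc e) h' ray
  open Nat using (_+_; _*_)
  open Nonsingular (suc e) h'

  sibling : ∀ k → Fin (branch d k) → Fin (branch d k)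
  sibling zero    zero    = suc zero
  sibling zero    (suc _) = zero
  sibling (suc _) zero    = suc zero
  sibling (suc _) (suc _) = zero

  sibling-≢ : ∀ k i → (toℕ (sibling k i) ≡ᵇ toℕ i) ≡ false
  sibling-≢ zero    zero    = refl
  sibling-≢ zero    (suc _) = refl
  sibling-≢ (suc _) zero    = refl
  sibling-≢ (suc _) (suc _) = refl

  descend : ∀ {x} → Path d x → (t : ℕ) → Path d (t + x)
  descend p zero          = p
  descend {x} p (suc t)   = descend p t , firstChild (t + x)

  descend-offRay : ∀ {x} (p : Path d x) → onRay p ≡ false → ∀ t →
    onRay (descend p t) ≡ false × meet (descend p t) ≡ meet p
  descend-offRay p off zero    = off , refl
  descend-offRay {x} p off (suc t) with descend-offRay p off t
  ... | off′ , meet≡ = offRay-child , trans (meet-offRay (descend p t) (firstChild (t + x)) offRay-child) meet≡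
    where
    offRay-child : onRay (descend p (suc t)) ≡ false
    offRay-child = cong (_∧ (toℕ (firstChild (t + x)) ≡ᵇ toℕ (ray (t + x)))) off′

  meet≤depth : ∀ {x} (p : Path d x) → meet p ≤ x
  meet≤depth {zero}  _       = z≤n
  meet≤depth {suc x} (p , i) with onRay (p , i)
  ... | true  = ℕᵖ.≤-refl
  ... | false = ℕᵖ.m≤n⇒m≤1+n (meet≤depth p)

  green-realizes : ∀ {k y} → k ≤ y → y ≤ h → Σ (Vertex d h) λ v → green v ≡ + (Γ k * Ψ y)
  green-realizes {k} {y} k≤y y≤h with ℕᵖ.m≤n⇒m<n∨m≡n k≤y
  ... | inj₂ refl = vtx k y≤h (prefix ray k) ,
    cong (λ m → + (Γ m * Ψ k)) (meet-onRay (prefix ray k) (eqPath-refl (prefix ray k)))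
  ... | inj₁ k<y = vtx (t + suc k) (subst (_≤ h) (sym t+1+k≡y) y≤h) (descend branchPoint t) ,
    cong₂ (λ m z → + (Γ m * Ψ z)) (trans (proj₂ (descend-offRay branchPoint off t)) meet≡k) t+1+k≡y
    where
    t : ℕ
    t = y Nat.∸ suc k
    t+1+k≡y : t + suc k ≡ y
    t+1+k≡y = ℕᵖ.m∸n+n≡m k<y
    branchPoint : Path d (suc k)
    branchPoint = prefix ray k , sibling k (ray k)
    off : onRay branchPoint ≡ false
    off rewrite eqPath-refl (prefix ray k) = sibling-≢ k (ray k)
    meet≡k : meet branchPoint ≡ k
    meet≡k = trans (meet-offRay (prefix ray k) (sibling k (ray k)) off)
                   (meet-onRay (prefix ray k) (eqPath-refl (prefix ray k)))

  coefficient : ZV d h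
  coefficient (vtx x x≤h p) = + quotient (g∣ΓΨ (meet≤depth p) (recompute (x Nat.≤? h) x≤h))

  green≡g*coefficient : ∀ j → green j ≡ + g Int.* coefficient j
  green≡g*coefficient (vtx x x≤h p) = begin
    + (Γ (meet p) * Ψ x)    ≡⟨ cong +_ (_∣_.equality g∣green) ⟩
    + (quotient g∣green * g) ≡⟨ ℤᵖ.pos-* (quotient g∣green) g ⟩
    + quotient g∣green Int.* + g ≡⟨ ℤᵖ.*-comm (+ quotient g∣green) (+ g) ⟩
    + g Int.* + quotient g∣green ∎
    where
    open ≡-Reasoning
    g∣green : g ∣ Γ (meet p) * Ψ x
    g∣green = g∣ΓΨ (meet≤depth p) (recompute (x Nat.≤? h) x≤h)

  annihilates-rayLeaf : Annihilates leafOrder (basis rayLeaf)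
  annihilates-rayLeaf = coefficient , λ k →
    ℤᵖ.*-cancelˡ-≡ (+ g) _ _ {{Nat.≢-nonZero g≢0}} (begin
      + g Int.* (+ leafOrder Int.* basis rayLeaf k)  ≡⟨ regroup (+ g) (+ leafOrder) (basis rayLeaf k) ⟩
      (+ leafOrder Int.* + g) Int.* basis rayLeaf k
        ≡⟨ cong (Int._* basis rayLeaf k) (trans (cong +_ D≡leafOrder*g) (ℤᵖ.pos-* leafOrder g)) ⟨
      + D Int.* basis rayLeaf k                      ≡⟨ combo-green k ⟨
      combo green k                                  ≡⟨ combo-cong green≡g*coefficient k ⟩
      combo (λ j → + g Int.* coefficient j) k        ≡⟨ combo-* (+ g) coefficient k ⟩
      + g Int.* combo coefficient k                  ∎)
    where
    open ≡-Reasoning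
    regroup : ∀ a b c → a Int.* (b Int.* c) ≡ (b Int.* a) Int.* c
    regroup = ℤ-Solver.solve-∀

  leafOrder-minimal : ∀ m → 0 < m → Annihilates m (basis rayLeaf) → leafOrder ≤ m
  leafOrder-minimal m m>0 (c , mℓ≡combo-c) =
    ∣⇒≤ {{Nat.>-nonZero m>0}} (*-cancelʳ-∣ g {{Nat.≢-nonZero g≢0}} (subst (_∣ m * g) D≡leafOrder*g D∣m*g))
    where
    open Int using () renaming (_+_ to _+ᶻ_; _*_ to _*ᶻ_)

    difference : ZV d h
    difference j = + D *ᶻ c j +ᶻ (- + m) *ᶻ green j

    combo-difference : ∀ k → combo difference k ≡ + 0
    combo-difference k = begin
      combo difference k
        ≡⟨ combo-+ (λ j → + D *ᶻ c j) (λ j → (- + m) *ᶻ green j) k ⟩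
      combo (λ j → + D *ᶻ c j) k +ᶻ combo (λ j → (- + m) *ᶻ green j) k
        ≡⟨ cong₂ _+ᶻ_ (combo-* (+ D) c k) (combo-* (- + m) green k) ⟩
      + D *ᶻ combo c k +ᶻ (- + m) *ᶻ combo green k
        ≡⟨ cong₂ (λ x y → + D *ᶻ x +ᶻ (- + m) *ᶻ y) (sym (mℓ≡combo-c k)) (combo-green k) ⟩
      + D *ᶻ (+ m *ᶻ basis rayLeaf k) +ᶻ (- + m) *ᶻ (+ D *ᶻ basis rayLeaf k)
        ≡⟨ cancel (+ D) (+ m) (basis rayLeaf k) ⟩
      + 0 ∎
      where
      open ≡-Reasoning
      cancel : ∀ δ μ b → δ *ᶻ (μ *ᶻ b) +ᶻ (- μ) *ᶻ (δ *ᶻ b) ≡ + 0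
      cancel = ℤ-Solver.solve-∀

    D*c≡m*green : ∀ j → + D *ᶻ c j ≡ + m *ᶻ green j
    D*c≡m*green j = ℤᵖ.i-j≡0⇒i≡j (+ D *ᶻ c j) (+ m *ᶻ green j)
      (trans (cong (_+ᶻ_ (+ D *ᶻ c j)) (ℤᵖ.neg-distribˡ-* (+ m) (green j)))
             (combo≡0⇒≡0 difference combo-difference j))

    D∣m*ΓΨ : ∀ {k y} → k ≤ y → y ≤ h → D ∣ m * (Γ k * Ψ y)
    D∣m*ΓΨ k≤y y≤h with green-realizes k≤y y≤h
    ... | v , green-v = +*≡+⇒∣ D _ (c v)
      (trans (D*c≡m*green v) (trans (cong (+ m *ᶻ_) green-v) (sym (ℤᵖ.pos-* m _))))

    D∣m*g : D ∣ m * g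
    D∣m*g = ∣-*-g {D} {m} (n∣m*n m) D∣m*ΓΨ

  rayLeaf-IsOrder : IsOrder (basis rayLeaf) leafOrder
  rayLeaf-IsOrder = leafOrder-pos , annihilates-rayLeaf , leafOrder-minimal

module Exponent (e h' : ℕ) where
  open Coefficients (suc e) h'

  leaf-IsOrder : ∀ .(h≤h : h ≤ h) (p : Path d h) → IsOrder (basis (vtx h h≤h p)) leafOrder
  leaf-IsOrder _ p = subst (λ p′ → IsOrder (basis (vtx h ℕᵖ.≤-refl p′)) leafOrder)
    (prefix-rayThrough p firstChild) (LeafOrder.rayLeaf-IsOrder e h' (rayThrough p firstChild))

  annihilates-basis : ∀ t {x} .(x≤h : x ≤ h) (p : Path d x) → x Nat.+ t ≡ h →
    Annihilates leafOrder (basis (vtx x x≤h p))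
  annihilates-parentTerm : ∀ t {x} (p : Path d x) z .(1+x≤h : suc x ≤ h) → suc x Nat.+ t ≡ h →
    Annihilates leafOrder (parentTerm (basis (vtx (suc x) 1+x≤h (p , z))))

  annihilates-basis zero {x} x≤h p x+0≡h = at-leaf (trans (sym (ℕᵖ.+-identityʳ x)) x+0≡h) x≤h p
    where
    at-leaf : ∀ {x} → x ≡ h → ∀ .(x≤h : x ≤ h) (p : Path d x) → Annihilates leafOrder (basis (vtx x x≤h p))
    at-leaf refl h≤h p = proj₁ (proj₂ (leaf-IsOrder h≤h p))
  annihilates-basis (suc t) {x} x≤h p x+1+t≡h =
    Annihilates-cong {n = leafOrder} (childTerm-basis x≤h p (firstChild x) 1+x≤h)
      (Annihilates-childTerm leafOrder _
        (annihilates-basis t 1+x≤h (p , firstChild x) 1+x+t≡h)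
        (annihilates-parentTerm t p (firstChild x) 1+x≤h 1+x+t≡h))
    where
    1+x+t≡h : suc x Nat.+ t ≡ h
    1+x+t≡h = trans (sym (ℕᵖ.+-suc x t)) x+1+t≡h
    1+x≤h : suc x ≤ h
    1+x≤h = subst (suc x ≤_) 1+x+t≡h (ℕᵖ.m≤m+n (suc x) t)

  annihilates-parentTerm zero {x} p z 1+x≤h 1+x+0≡h =
    Annihilates-cong {n = leafOrder} (λ k → sym (parentTerm-basis-leaf p z 1+x≤h 1+x≡h k)) (Annihilates-0 leafOrder)
    where
    1+x≡h : suc x ≡ h
    1+x≡h = trans (sym (ℕᵖ.+-identityʳ (suc x))) 1+x+0≡h
  annihilates-parentTerm (suc t) {x} p z 1+x≤h 1+x+1+t≡h =
    Annihilates-cong {n = leafOrder} (λ k → sym (parentTerm-basis p z 1+x≤h 2+x≤h k))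
      (Annihilates-sumFin {n = leafOrder} (branch d (suc x)) (λ i → annihilates-basis t 2+x≤h ((p , z) , i) 2+x+t≡h))
    where
    2+x+t≡h : suc (suc x) Nat.+ t ≡ h
    2+x+t≡h = trans (sym (ℕᵖ.+-suc (suc x) t)) 1+x+1+t≡h
    2+x≤h : suc (suc x) ≤ h
    2+x≤h = subst (suc (suc x) ≤_) 2+x+t≡h (ℕᵖ.m≤m+n (suc (suc x)) t)

  annihilates-all : (v : ZV d h) → Annihilates leafOrder v
  annihilates-all v = InL-cong (λ k → sumVertex-select (λ j → + leafOrder Int.* v j) k)
    (InL-sumVertex λ j → InL-cong (λ k → swap (v j) (+ leafOrder) (basis j k)) (InL-* (v j) (annihilates-basis-at j)))
    where
    annihilates-basis-at : ∀ j → Annihilates leafOrder (basis j)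
    annihilates-basis-at (vtx x x≤h p) =
      annihilates-basis (h Nat.∸ x) x≤h p (ℕᵖ.m+[n∸m]≡n (recompute (x Nat.≤? h) x≤h))
    swap : ∀ a n b → a Int.* (n Int.* b) ≡ (n Int.* a) Int.* b
    swap = ℤ-Solver.solve-∀

lemma7p4 : (d h : ℕ) → 3 ≤ d → 1 ≤ h → (ℓ : Vertex d h) → depth ℓ ≡ h →
    ∃ λ (n : ℕ) → IsOrder (basis ℓ) n × IsExponent d h n
lemma7p4 (suc (suc (suc e))) (suc h') (s≤s (s≤s (s≤s z≤n))) (s≤s z≤n) (vtx _ ℓ≤h p) refl =
  leafOrder , ℓ-IsOrder , (λ v m v-IsOrder → IsOrder-∣ v-IsOrder (annihilates-all v)) ,
  (λ k orders∣k → orders∣k _ leafOrder ℓ-IsOrder)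
  where
  open Coefficients (suc e) h'
  open Exponent e h'
  ℓ-IsOrder : IsOrder (basis (vtx h ℓ≤h p)) leafOrder
  ℓ-IsOrder = leaf-IsOrder ℓ≤h p
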